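{- Let $m,n,m',n'$ be nonnegative integers and $l,k,a,r$ integers. Suppose there is a perfect $2^l$-coloring of $D(m,n)$ with quotient matrix $k(J-E)+aE$, and suppose there are $2^l$ perfect $2$-colorings $f_1,\ldots,f_{2^l}$ of $D(m',n')$, each with quotient matrix $\begin{pmatrix} a'&b'\\ c'&d'\end{pmatrix}$, such that every vertex of $D(m',n')$ has color $1$ in exactly $r$ of these colorings. Then there are $2^l$ perfect $2$-colorings of $D(m+m',n+n')$, each with quotient matrix $$\begin{pmatrix} a'+a+(r-1)k & b'+(2^l-r)k\\ c'+rk & d'+(2^l-r-1)k+a\end{pmatrix},$$ such that every vertex of $D(m+m',n+n')$ has color $1$ in exactly $r$ of these colorings.
   Context: The Shrikhande graph is the Cayley graph on $\mathbb{Z}_4^2$ with connection set $\{01,03,10,30,11,33\}$. For nonnegative integers $m,n$, $D(m,n)$ is the Cartesian product of $m$ copies of the Shrikhande graph and $n$ copies of $K_4$ (vertex set $(\mathbb{Z}_4^2)^m\times\mathbb{Z}_4^n$; adjacent iff differing in exactly one coordinate by an adjacency of that factor). A $k$-coloring is a surjective map onto a $k$-element color set; it is perfect with quotient matrix $S=(s_{ij})$ if every vertex of color $i$ has exactly $s_{ij}$ neighbours of color $j$; $2$-colorings use colors $1,2$. $J$ is the all-ones and $E$ the identity $2^l\times 2^l$ matrix. -}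

module Defs where

open import Data.Nat using (ℕ; zero; suc; _+_; _^_)
open import Data.Nat.DivMod using (_mod_)
open import Data.Fin using (Fin; zero; suc; toℕ; _≟_)
open import Data.Fin.Properties using () renaming (_≟_ to _≟ᶠ_)
open import Data.Product using (_×_; _,_; ∃)
open import Data.List using (List; []; _∷_; map; concatMap; filter; length; allFin; _++_)
open import Data.Vec using (Vec; lookup; _[_]%=_; _[_]≔_)
open import Data.Integer using (ℤ; +_)
open import Relation.Binary.PropositionalEquality using (_≡_)
open import Relation.Nullary using (¬?)

Z4 : Set
Z4 = Fin 4

_⊕_ : Z4 → Z4 → Z4
x ⊕ y = (toℕ x + toℕ y) mod 4

Sh : Set
Sh = Z4 × Z4

_⊕ₛ_ : Sh → Sh → Sh
(x₁ , x₂) ⊕ₛ (y₁ , y₂) = (x₁ ⊕ y₁) , (x₂ ⊕ y₂)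

pattern z0 = zero
pattern z1 = suc zero
pattern z3 = suc (suc (suc zero))

connSet : List Sh
connSet = (z0 , z1) ∷ (z0 , z3) ∷ (z1 , z0) ∷ (z3 , z0) ∷ (z1 , z1) ∷ (z3 , z3) ∷ []

V : ℕ → ℕ → Set
V m n = Vec Sh m × Vec Z4 n

-- neighbours in the Cartesian power of the Shrikhande graph:
-- change exactly one coordinate x_i to x_i + s with s in the connection set
shNbrs : ∀ {m} → Vec Sh m → List (Vec Sh m)
shNbrs {m} xs = concatMap (λ i → map (λ s → xs [ i ]%= (_⊕ₛ s)) connSet) (allFin m)

-- neighbours in the Cartesian power of K₄:
-- change exactly one coordinate to a different value
k4Nbrs : ∀ {n} → Vec Z4 n → List (Vec Z4 n)
k4Nbrs {n} ys =
  concatMap (λ i → map (λ c → ys [ i ]≔ c) (filter (λ c → ¬? (c ≟ᶠ lookup ys i)) (allFin 4))) (allFin n)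

-- the list of all neighbours of a vertex of D(m,n)
-- (each neighbour occurs exactly once)
neighbours : ∀ {m n} → V m n → List (V m n)
neighbours (xs , ys) = map (λ xs' → xs' , ys) (shNbrs xs) ++ map (λ ys' → xs , ys') (k4Nbrs ys)

nbrCount : ∀ {m n K} → (V m n → Fin K) → V m n → Fin K → ℕ
nbrCount f v j = length (filter (λ w → f w ≟ᶠ j) (neighbours v))

IsPerfectColoring : ∀ {m n K} → (V m n → Fin K) → (Fin K → Fin K → ℤ) → Set
IsPerfectColoring {m} {n} {K} f S =
  (∀ (c : Fin K) → ∃ λ (v : V m n) → f v ≡ c) ×
  (∀ (v : V m n) (j : Fin K) → + nbrCount f v j ≡ S (f v) j)

kJEaE : ∀ {K} → ℤ → ℤ → Fin K → Fin K → ℤ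
kJEaE k a i j with i ≟ᶠ j
... | Relation.Nullary.yes _ = a
... | Relation.Nullary.no _ = k

-- 2×2 matrix (colour 1 ↦ index zero, colour 2 ↦ index suc zero)
mat2 : ℤ → ℤ → ℤ → ℤ → Fin 2 → Fin 2 → ℤ
mat2 a b c d zero zero = a
mat2 a b c d zero (suc zero) = b
mat2 a b c d (suc zero) zero = c
mat2 a b c d (suc zero) (suc zero) = d

col1 : Fin 2
col1 = zero

col1Count : ∀ {m n L} → (Fin L → V m n → Fin 2) → V m n → ℕ
col1Count {L = L} fs v = length (filter (λ i → fs i v ≟ᶠ col1) (allFin L))

-- Write D(m+m', n+n') = D(m,n) □ D(m',n') and let the i-th new colouring be
-- h_i(u, w) = f_{i+g(u)}(w), indices in the cyclic group of order L = 2^l.  A vertex (u, w) has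
-- the neighbours (u, w'), on which h_i is the perfect colouring f_{i+g(u)}, and the neighbours
-- (u', w): u has k neighbours of each colour c ≠ g(u) and a of colour g(u), so these contribute
-- k·#{c : f_c(w) = j} + (a − k)·[h_i(u, w) = j] vertices of colour j, where the class sizes
-- #{c : f_c(w) = j} are r and L − r.  Since i ↦ i + g(u) is a bijection, (u, w) has colour 1
-- under exactly r of the h_i.  Only this group structure on the index set is used, so L is arbitrary.

module Submission where

open import Defs
open import Data.Nat using (ℕ; zero; suc; _+_; _^_; _∸_; NonZero)
open import Data.Nat.DivMod using (_%_; _mod_; %-distribˡ-+; m%n%n≡m%n; [m+n]%n≡m%n; m<n⇒m%n≡m)
import Data.Nat.Properties as ℕ
open import Data.Fin using (Fin; zero; suc; toℕ)
open import Data.Fin.Properties using (toℕ-injective; toℕ-fromℕ<; toℕ<n; toℕ≤n) renaming (_≟_ to _≟ᶠ_)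
open import Data.Fin.Permutation using (Permutation; permutation)
open import Data.Product using (_×_; _,_; proj₁; proj₂; ∃; uncurry)
open import Data.List using (List; []; _∷_; map; filter; length; concat; concatMap; allFin; tabulate; _++_)
open import Data.List.Properties using (length-++; filter-++; filter-≐; map-∘; map-tabulate; map-concatMap; concatMap-cong)
open import Data.Vec using (Vec; []; _∷_; lookup; take; drop; _[_]%=_) renaming (_++_ to _++ᵥ_)
open import Data.Vec.Properties using (take++drop≡id; ++-injective)
open import Data.Bool using (if_then_else_)
open import Data.Integer using (ℤ; +_) renaming (_+_ to _+ℤ_; _*_ to _*ℤ_; _-_ to _-ℤ_)
import Data.Integer.Properties as ℤ
open import Data.Integer.Tactic.RingSolver using (solve-∀)
open import Algebra.Properties.Semiring.Sum ℤ.+-*-semiring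
  using (sum; sum-cong-≗; sum-replicate-zero; ∑-distrib-+; *-distribˡ-sum; sum-permute)
open import Algebra.Properties.CommutativeSemigroup ℕ.+-commutativeSemigroup using (interchange)
open import Relation.Nullary using (Dec; yes; no; does; ¬?)
open import Relation.Unary using (Decidable)
open import Relation.Binary.PropositionalEquality
  using (_≡_; _≗_; refl; sym; trans; cong; cong₂; subst; module ≡-Reasoning)
open import Function using (_∘_; id)

count : ∀ {A : Set} {P : A → Set} → Decidable P → List A → ℕ
count P? = length ∘ filter P?

count-++ : ∀ {A : Set} {P : A → Set} (P? : Decidable P) xs ys →
  count P? (xs ++ ys) ≡ count P? xs + count P? ys
count-++ P? xs ys = trans (cong length (filter-++ P? xs ys)) (length-++ (filter P? xs))

count-map : ∀ {A B : Set} {P : A → Set} (P? : Decidable P) (f : B → A) xs →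
  count P? (map f xs) ≡ count (P? ∘ f) xs
count-map P? f [] = refl
count-map P? f (x ∷ xs) with P? (f x)
... | yes _ = cong suc (count-map P? f xs)
... | no _  = count-map P? f xs

count-≗ : ∀ {X : Set} {K} {f g : X → Fin K} → f ≗ g → ∀ j xs →
  count (λ x → f x ≟ᶠ j) xs ≡ count (λ x → g x ≟ᶠ j) xs
count-≗ f≗g j xs =
  cong length (filter-≐ _ _ ((λ {x} e → trans (sym (f≗g x)) e) , (λ {x} e → trans (f≗g x) e)) xs)

module CoordinateChanges {A B : Set} (act : B → A → A) (moves : A → List B) where

  nbrs : ∀ {m} → Vec A m → List (Vec A m)
  nbrs {m} xs = concatMap (λ i → map (λ e → xs [ i ]%= act e) (moves (lookup xs i))) (allFin m)

  nbrs-∷ : ∀ {m} x (xs : Vec A m) →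
    nbrs (x ∷ xs) ≡ map (λ e → act e x ∷ xs) (moves x) ++ map (x ∷_) (nbrs xs)
  nbrs-∷ {m} x xs = cong (map (λ e → act e x ∷ xs) (moves x) ++_) (begin
    concatMap change (tabulate suc)          ≡⟨ cong concat (map-tabulate suc change) ⟩
    concat (tabulate (change ∘ suc))         ≡⟨ cong concat (sym (map-tabulate id (change ∘ suc))) ⟩
    concatMap (change ∘ suc) (allFin m)      ≡⟨ concatMap-cong (λ i → map-∘ (moves (lookup xs i))) (allFin m) ⟩
    concatMap (map (x ∷_) ∘ change′) (allFin m) ≡⟨ sym (map-concatMap (x ∷_) change′ (allFin m)) ⟩
    map (x ∷_) (nbrs xs) ∎)
    where
    open ≡-Reasoning
    change : Fin (suc m) → List (Vec A (suc m))
    change i = map (λ e → (x ∷ xs) [ i ]%= act e) (moves (lookup (x ∷ xs) i))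
    change′ : Fin m → List (Vec A m)
    change′ i = map (λ e → xs [ i ]%= act e) (moves (lookup xs i))

  count-nbrs-∷ : ∀ {m} {P : Vec A (suc m) → Set} (P? : Decidable P) x (xs : Vec A m) →
    count P? (nbrs (x ∷ xs)) ≡ count (λ e → P? (act e x ∷ xs)) (moves x) + count (P? ∘ (x ∷_)) (nbrs xs)
  count-nbrs-∷ P? x xs = begin
    count P? (nbrs (x ∷ xs))
      ≡⟨ cong (count P?) (nbrs-∷ x xs) ⟩
    count P? (map moved (moves x) ++ map (x ∷_) (nbrs xs))
      ≡⟨ count-++ P? (map moved (moves x)) (map (x ∷_) (nbrs xs)) ⟩
    count P? (map moved (moves x)) + count P? (map (x ∷_) (nbrs xs))
      ≡⟨ cong₂ _+_ (count-map P? moved (moves x)) (count-map P? (x ∷_) (nbrs xs)) ⟩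
    count (P? ∘ moved) (moves x) + count (P? ∘ (x ∷_)) (nbrs xs) ∎
    where
    open ≡-Reasoning
    moved = λ e → act e x ∷ xs

  count-nbrs-++ : ∀ {m m'} {P : Vec A (m + m') → Set} (P? : Decidable P) (xs : Vec A m) (ys : Vec A m') →
    count P? (nbrs (xs ++ᵥ ys)) ≡ count (P? ∘ (_++ᵥ ys)) (nbrs xs) + count (P? ∘ (xs ++ᵥ_)) (nbrs ys)
  count-nbrs-++ P? [] ys = refl
  count-nbrs-++ P? (x ∷ xs) ys = begin
    count P? (nbrs (x ∷ xs ++ᵥ ys))
      ≡⟨ count-nbrs-∷ P? x (xs ++ᵥ ys) ⟩
    atHead + count (P? ∘ (x ∷_)) (nbrs (xs ++ᵥ ys))
      ≡⟨ cong (λ t → atHead + t) (count-nbrs-++ (P? ∘ (x ∷_)) xs ys) ⟩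
    atHead + (count (P? ∘ (x ∷_) ∘ (_++ᵥ ys)) (nbrs xs) + count (P? ∘ ((x ∷ xs) ++ᵥ_)) (nbrs ys))
      ≡⟨ sym (ℕ.+-assoc atHead _ _) ⟩
    atHead + count (P? ∘ (x ∷_) ∘ (_++ᵥ ys)) (nbrs xs) + count (P? ∘ ((x ∷ xs) ++ᵥ_)) (nbrs ys)
      ≡⟨ cong (_+ count (P? ∘ ((x ∷ xs) ++ᵥ_)) (nbrs ys)) (sym (count-nbrs-∷ (P? ∘ (_++ᵥ ys)) x xs)) ⟩
    count (P? ∘ (_++ᵥ ys)) (nbrs (x ∷ xs)) + count (P? ∘ ((x ∷ xs) ++ᵥ_)) (nbrs ys) ∎
    where
    open ≡-Reasoning
    atHead = count (λ e → P? (act e x ∷ xs ++ᵥ ys)) (moves x)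

-- shNbrs and k4Nbrs are, by definition, the neighbour lists of these two instances.
module Shrikhande = CoordinateChanges (λ s → _⊕ₛ s) (λ _ → connSet)
module K₄ = CoordinateChanges (λ c _ → c) (λ y → filter (λ c → ¬? (c ≟ᶠ y)) (allFin 4))

count-neighbours : ∀ {m n} {P : V m n → Set} (P? : Decidable P) (xs : Vec Sh m) (ys : Vec Z4 n) →
  count P? (neighbours (xs , ys)) ≡ count (P? ∘ (_, ys)) (shNbrs xs) + count (P? ∘ (xs ,_)) (k4Nbrs ys)
count-neighbours P? xs ys = trans (count-++ P? (map (_, ys) (shNbrs xs)) _)
  (cong₂ _+_ (count-map P? (_, ys) (shNbrs xs)) (count-map P? (xs ,_) (k4Nbrs ys)))

take-drop-++ : ∀ {A : Set} {m m'} (xs : Vec A m) (ys : Vec A m') →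
  take m (xs ++ᵥ ys) ≡ xs × drop m (xs ++ᵥ ys) ≡ ys
take-drop-++ {m = m} xs ys = ++-injective (take m (xs ++ᵥ ys)) xs (take++drop≡id m (xs ++ᵥ ys))

join : ∀ {m n m' n'} → V m n → V m' n' → V (m + m') (n + n')
join (xs , ys) (xs' , ys') = xs ++ᵥ xs' , ys ++ᵥ ys'

split : ∀ m n {m' n'} → V (m + m') (n + n') → V m n × V m' n'
split m n (xs , ys) = (take m xs , take n ys) , (drop m xs , drop n ys)

join-split : ∀ m n {m' n'} (v : V (m + m') (n + n')) → uncurry join (split m n v) ≡ v
join-split m n (xs , ys) = cong₂ _,_ (take++drop≡id m xs) (take++drop≡id n ys)

split-join : ∀ {m n m' n'} (u : V m n) (w : V m' n') → split m n (join u w) ≡ (u , w)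
split-join (xs , ys) (xs' , ys') =
  cong₂ _,_ (cong₂ _,_ takeˣ takeʸ) (cong₂ _,_ dropˣ dropʸ)
  where
  takeˣ = proj₁ (take-drop-++ xs xs')
  dropˣ = proj₂ (take-drop-++ xs xs')
  takeʸ = proj₁ (take-drop-++ ys ys')
  dropʸ = proj₂ (take-drop-++ ys ys')

join-elim : ∀ {m n m' n'} {P : V (m + m') (n + n') → Set} →
  (∀ u w → P (join u w)) → ∀ v → P v
join-elim {m} {n} {P = P} P-join v = subst P (join-split m n v) (uncurry P-join (split m n v))

count-neighbours-join : ∀ {m n m' n'} {P : V (m + m') (n + n') → Set} (P? : Decidable P) (u : V m n) (w : V m' n') →
  count P? (neighbours (join u w))
    ≡ count (P? ∘ (λ u' → join u' w)) (neighbours u) + count (P? ∘ join u) (neighbours w)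
count-neighbours-join P? (xs , ys) (xs' , ys') = begin
  count P? (neighbours (xs ++ᵥ xs' , ys ++ᵥ ys'))
    ≡⟨ count-neighbours P? (xs ++ᵥ xs') (ys ++ᵥ ys') ⟩
  count (P? ∘ (_, ys ++ᵥ ys')) (shNbrs (xs ++ᵥ xs')) + count (P? ∘ (xs ++ᵥ xs' ,_)) (k4Nbrs (ys ++ᵥ ys'))
    ≡⟨ cong₂ _+_ (Shrikhande.count-nbrs-++ (P? ∘ (_, ys ++ᵥ ys')) xs xs')
                 (K₄.count-nbrs-++ (P? ∘ (xs ++ᵥ xs' ,_)) ys ys') ⟩
  (a + b) + (c + d)
    ≡⟨ interchange a b c d ⟩
  (a + c) + (b + d)
    ≡⟨ sym (cong₂ _+_ (count-neighbours (P? ∘ (λ u' → join u' (xs' , ys'))) xs ys)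
                      (count-neighbours (P? ∘ join (xs , ys)) xs' ys')) ⟩
  count (P? ∘ (λ u' → join u' (xs' , ys'))) (neighbours (xs , ys))
    + count (P? ∘ join (xs , ys)) (neighbours (xs' , ys')) ∎
  where
  open ≡-Reasoning
  a = count (λ z → P? (z ++ᵥ xs' , ys ++ᵥ ys')) (shNbrs xs)
  b = count (λ z → P? (xs ++ᵥ z , ys ++ᵥ ys')) (shNbrs xs')
  c = count (λ z → P? (xs ++ᵥ xs' , z ++ᵥ ys')) (k4Nbrs ys)
  d = count (λ z → P? (xs ++ᵥ xs' , ys ++ᵥ z)) (k4Nbrs ys')

⟦_⟧ : ∀ {P : Set} → Dec P → ℤ
⟦ P? ⟧ = if does P? then + 1 else + 0

count-∷ : ∀ {A : Set} {P : A → Set} (P? : Decidable P) x xs →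
  + count P? (x ∷ xs) ≡ ⟦ P? x ⟧ +ℤ + count P? xs
count-∷ P? x xs with P? x
... | yes _ = refl
... | no _  = sym (ℤ.+-identityˡ _)

count-tabulate : ∀ {A : Set} {P : A → Set} {n} (P? : Decidable P) (f : Fin n → A) →
  + count P? (tabulate f) ≡ sum (λ i → ⟦ P? (f i) ⟧)
count-tabulate {n = zero} P? f = refl
count-tabulate {n = suc n} P? f =
  trans (count-∷ P? (f zero) (tabulate (f ∘ suc))) (cong (⟦ P? (f zero) ⟧ +ℤ_) (count-tabulate P? (f ∘ suc)))

sum-*-zero : ∀ {n} (F : Fin n → ℤ) → sum (λ c → F c *ℤ + 0) ≡ + 0
sum-*-zero {n} F = trans (sum-cong-≗ (ℤ.*-zeroʳ ∘ F)) (sum-replicate-zero n)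

sum-δ : ∀ {n} (F : Fin n → ℤ) a → sum (λ c → F c *ℤ ⟦ a ≟ᶠ c ⟧) ≡ F a
sum-δ F zero = trans (cong₂ _+ℤ_ (ℤ.*-identityʳ (F zero)) (sum-*-zero (λ c → F (suc c)))) (ℤ.+-identityʳ (F zero))
sum-δ F (suc a) = trans (cong₂ _+ℤ_ (ℤ.*-zeroʳ (F zero)) (sum-δ (λ c → F (suc c)) a)) (ℤ.+-identityˡ (F (suc a)))

sum-1 : ∀ n → sum {n} (λ _ → + 1) ≡ + n
sum-1 zero = refl
sum-1 (suc n) = cong (+ 1 +ℤ_) (sum-1 n)

count-∘-sum-fibres : ∀ {K} {X : Set} {Q : Fin K → Set} (Q? : Decidable Q) (g : X → Fin K) xs →
  + count (Q? ∘ g) xs ≡ sum (λ c → ⟦ Q? c ⟧ *ℤ + count (λ x → g x ≟ᶠ c) xs)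
count-∘-sum-fibres Q? g [] = sym (sum-*-zero (λ c → ⟦ Q? c ⟧))
count-∘-sum-fibres Q? g (x ∷ xs) = begin
  + count (Q? ∘ g) (x ∷ xs)
    ≡⟨ count-∷ (Q? ∘ g) x xs ⟩
  ⟦ Q? (g x) ⟧ +ℤ + count (Q? ∘ g) xs
    ≡⟨ cong₂ _+ℤ_ (sym (sum-δ (λ c → ⟦ Q? c ⟧) (g x))) (count-∘-sum-fibres Q? g xs) ⟩
  sum (λ c → ⟦ Q? c ⟧ *ℤ ⟦ g x ≟ᶠ c ⟧) +ℤ sum (λ c → ⟦ Q? c ⟧ *ℤ + count (fibre c) xs)
    ≡⟨ sym (∑-distrib-+ (λ c → ⟦ Q? c ⟧ *ℤ ⟦ g x ≟ᶠ c ⟧) _) ⟩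
  sum (λ c → ⟦ Q? c ⟧ *ℤ ⟦ g x ≟ᶠ c ⟧ +ℤ ⟦ Q? c ⟧ *ℤ + count (fibre c) xs)
    ≡⟨ sum-cong-≗ (λ c → sym (ℤ.*-distribˡ-+ ⟦ Q? c ⟧ _ _)) ⟩
  sum (λ c → ⟦ Q? c ⟧ *ℤ (⟦ g x ≟ᶠ c ⟧ +ℤ + count (fibre c) xs))
    ≡⟨ sum-cong-≗ (λ c → cong (⟦ Q? c ⟧ *ℤ_) (sym (count-∷ (fibre c) x xs))) ⟩
  sum (λ c → ⟦ Q? c ⟧ *ℤ + count (fibre c) (x ∷ xs)) ∎
  where
  open ≡-Reasoning
  fibre = λ c x → g x ≟ᶠ c

sum-colour-classes : ∀ {L} (f : Fin L → Fin 2) →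
  sum (λ c → ⟦ f c ≟ᶠ zero ⟧) +ℤ sum (λ c → ⟦ f c ≟ᶠ suc zero ⟧) ≡ + L
sum-colour-classes {L} f = begin
  sum (λ c → ⟦ f c ≟ᶠ zero ⟧) +ℤ sum (λ c → ⟦ f c ≟ᶠ suc zero ⟧)
    ≡⟨ sym (∑-distrib-+ (λ c → ⟦ f c ≟ᶠ zero ⟧) _) ⟩
  sum (λ c → ⟦ f c ≟ᶠ zero ⟧ +ℤ ⟦ f c ≟ᶠ suc zero ⟧)
    ≡⟨ sum-cong-≗ (one-class ∘ f) ⟩
  sum {L} (λ _ → + 1)
    ≡⟨ sum-1 L ⟩
  + L ∎
  where
  open ≡-Reasoning
  one-class : ∀ (x : Fin 2) → ⟦ x ≟ᶠ zero ⟧ +ℤ ⟦ x ≟ᶠ suc zero ⟧ ≡ + 1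
  one-class zero = refl
  one-class (suc zero) = refl

kJEaE-δ : ∀ {K} (k a : ℤ) (x c : Fin K) → kJEaE k a x c ≡ k +ℤ (a -ℤ k) *ℤ ⟦ x ≟ᶠ c ⟧
kJEaE-δ k a x c with x ≟ᶠ c
... | yes _ = a≡k+[a-k]*1 k a
  where
  a≡k+[a-k]*1 : ∀ k a → a ≡ k +ℤ (a -ℤ k) *ℤ + 1
  a≡k+[a-k]*1 = solve-∀
... | no _  = k≡k+[a-k]*0 k a
  where
  k≡k+[a-k]*0 : ∀ k a → k ≡ k +ℤ (a -ℤ k) *ℤ + 0
  k≡k+[a-k]*0 = solve-∀

count-neighbours-kJEaE : ∀ {m n K} {g : V m n → Fin K} {k a : ℤ} → IsPerfectColoring g (kJEaE k a) →
  ∀ {Q : Fin K → Set} (Q? : Decidable Q) u →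
  + count (Q? ∘ g) (neighbours u) ≡ k *ℤ sum (λ c → ⟦ Q? c ⟧) +ℤ (a -ℤ k) *ℤ ⟦ Q? (g u) ⟧
count-neighbours-kJEaE {g = g} {k} {a} (_ , regular) Q? u = begin
  + count (Q? ∘ g) (neighbours u)
    ≡⟨ count-∘-sum-fibres Q? g (neighbours u) ⟩
  sum (λ c → q c *ℤ + nbrCount g u c)
    ≡⟨ sum-cong-≗ (λ c → cong (q c *ℤ_) (trans (regular u c) (kJEaE-δ k a (g u) c))) ⟩
  sum (λ c → q c *ℤ (k +ℤ (a -ℤ k) *ℤ δ c))
    ≡⟨ sum-cong-≗ (λ c → distrib (q c) k (a -ℤ k) (δ c)) ⟩
  sum (λ c → k *ℤ q c +ℤ (a -ℤ k) *ℤ q c *ℤ δ c)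
    ≡⟨ ∑-distrib-+ (λ c → k *ℤ q c) (λ c → (a -ℤ k) *ℤ q c *ℤ δ c) ⟩
  sum (λ c → k *ℤ q c) +ℤ sum (λ c → (a -ℤ k) *ℤ q c *ℤ δ c)
    ≡⟨ cong₂ _+ℤ_ (sym (*-distribˡ-sum k q)) (sum-δ (λ c → (a -ℤ k) *ℤ q c) (g u)) ⟩
  k *ℤ sum q +ℤ (a -ℤ k) *ℤ q (g u) ∎
  where
  open ≡-Reasoning
  q = λ c → ⟦ Q? c ⟧
  δ = λ c → ⟦ g u ≟ᶠ c ⟧
  distrib : ∀ q k d δ → q *ℤ (k +ℤ d *ℤ δ) ≡ k *ℤ q +ℤ d *ℤ q *ℤ δ
  distrib = solve-∀

module Rotation (L : ℕ) .{{_ : NonZero L}} where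

  rotate : ℕ → Fin L → Fin L
  rotate p x = (toℕ x + p) mod L

  toℕ-rotate : ∀ p x → toℕ (rotate p x) ≡ (toℕ x + p) % L
  toℕ-rotate p x = toℕ-fromℕ< _

  rotate-rotate : ∀ {p q} → p + q ≡ L → ∀ x → rotate q (rotate p x) ≡ x
  rotate-rotate {p} {q} p+q≡L x = toℕ-injective (begin
    toℕ (rotate q (rotate p x))         ≡⟨ toℕ-rotate q (rotate p x) ⟩
    (toℕ (rotate p x) + q) % L          ≡⟨ cong (λ t → (t + q) % L) (toℕ-rotate p x) ⟩
    ((toℕ x + p) % L + q) % L           ≡⟨ %-distribˡ-+ ((toℕ x + p) % L) q L ⟩
    ((toℕ x + p) % L % L + q % L) % L   ≡⟨ cong (λ t → (t + q % L) % L) (m%n%n≡m%n (toℕ x + p) L) ⟩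
    ((toℕ x + p) % L + q % L) % L       ≡⟨ sym (%-distribˡ-+ (toℕ x + p) q L) ⟩
    (toℕ x + p + q) % L                 ≡⟨ cong (_% L) (ℕ.+-assoc (toℕ x) p q) ⟩
    (toℕ x + (p + q)) % L               ≡⟨ cong (λ t → (toℕ x + t) % L) p+q≡L ⟩
    (toℕ x + L) % L                     ≡⟨ [m+n]%n≡m%n (toℕ x) L ⟩
    toℕ x % L                           ≡⟨ m<n⇒m%n≡m (toℕ<n x) ⟩
    toℕ x                               ∎)
    where open ≡-Reasoning

  rotation : Fin L → Permutation L L
  rotation c = permutation (rotate (toℕ c)) (rotate (L ∸ toℕ c))
    (rotate-rotate (ℕ.m∸n+n≡m (toℕ≤n c))) (rotate-rotate (ℕ.m+[n∸m]≡n (toℕ≤n c)))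

  sum-rotate : ∀ (F : Fin L → ℤ) c → sum (F ∘ rotate (toℕ c)) ≡ sum F
  sum-rotate F c = sym (sum-permute F (rotation c))

  rotate-comm : ∀ (i c : Fin L) → rotate (toℕ c) i ≡ rotate (toℕ i) c
  rotate-comm i c = cong (_mod L) (ℕ.+-comm (toℕ i) (toℕ c))

productQuotient : ∀ (L : ℕ) (k a r a' b' c' d' : ℤ) → Fin 2 → Fin 2 → ℤ
productQuotient L k a r a' b' c' d' =
  mat2 (a' +ℤ a +ℤ (r -ℤ + 1) *ℤ k)
       (b' +ℤ (+ L -ℤ r) *ℤ k)
       (c' +ℤ r *ℤ k)
       (d' +ℤ (+ L -ℤ r -ℤ + 1) *ℤ k +ℤ a)

classSize : ℕ → ℤ → Fin 2 → ℤ
classSize L r zero = r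
classSize L r (suc zero) = + L -ℤ r

productQuotient-entry : ∀ L k a r a' b' c' d' (h j : Fin 2) →
  k *ℤ classSize L r j +ℤ (a -ℤ k) *ℤ ⟦ h ≟ᶠ j ⟧ +ℤ mat2 a' b' c' d' h j
    ≡ productQuotient L k a r a' b' c' d' h j
productQuotient-entry L k a r a' b' c' d' zero zero = solve₁ k a r a'
  where
  solve₁ : ∀ k a r a' → k *ℤ r +ℤ (a -ℤ k) *ℤ + 1 +ℤ a' ≡ a' +ℤ a +ℤ (r -ℤ + 1) *ℤ k
  solve₁ = solve-∀
productQuotient-entry L k a r a' b' c' d' zero (suc zero) = solve₂ k a r (+ L) b'
  where
  solve₂ : ∀ k a r L b' → k *ℤ (L -ℤ r) +ℤ (a -ℤ k) *ℤ + 0 +ℤ b' ≡ b' +ℤ (L -ℤ r) *ℤ k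
  solve₂ = solve-∀
productQuotient-entry L k a r a' b' c' d' (suc zero) zero = solve₃ k a r c'
  where
  solve₃ : ∀ k a r c' → k *ℤ r +ℤ (a -ℤ k) *ℤ + 0 +ℤ c' ≡ c' +ℤ r *ℤ k
  solve₃ = solve-∀
productQuotient-entry L k a r a' b' c' d' (suc zero) (suc zero) = solve₄ k a r (+ L) d'
  where
  solve₄ : ∀ k a r L d' → k *ℤ (L -ℤ r) +ℤ (a -ℤ k) *ℤ + 1 +ℤ d' ≡ d' +ℤ (L -ℤ r -ℤ + 1) *ℤ k +ℤ a
  solve₄ = solve-∀

module ProductConstruction {m n m' n' L} .{{_ : NonZero L}} {k a r a' b' c' d' : ℤ}
  (g : V m n → Fin L) (g-perfect : IsPerfectColoring g (kJEaE k a))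
  (fs : Fin L → V m' n' → Fin 2) (fs-perfect : ∀ i → IsPerfectColoring (fs i) (mat2 a' b' c' d'))
  (fs-col1Count : ∀ w → + col1Count fs w ≡ r) where

  open Rotation L

  colouring : Fin L → V m n → V m' n' → Fin 2
  colouring i u w = fs (rotate (toℕ i) (g u)) w

  hs : Fin L → V (m + m') (n + n') → Fin 2
  hs i = uncurry (colouring i) ∘ split m n

  hs-join : ∀ i u w → hs i (join u w) ≡ colouring i u w
  hs-join i u w = cong (uncurry (colouring i)) (split-join u w)

  multiplicity : V m' n' → Fin 2 → ℤ
  multiplicity w j = sum (λ c → ⟦ fs c w ≟ᶠ j ⟧)

  multiplicity≡classSize : ∀ w j → multiplicity w j ≡ classSize L r j
  multiplicity≡classSize w zero = trans (sym (count-tabulate (λ c → fs c w ≟ᶠ zero) id)) (fs-col1Count w)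
  multiplicity≡classSize w (suc zero) = begin
    multiplicity w (suc zero)
      ≡⟨ solve (multiplicity w zero) (multiplicity w (suc zero)) ⟩
    (multiplicity w zero +ℤ multiplicity w (suc zero)) -ℤ multiplicity w zero
      ≡⟨ cong₂ _-ℤ_ (sum-colour-classes (λ c → fs c w)) (multiplicity≡classSize w zero) ⟩
    + L -ℤ r ∎
    where
    open ≡-Reasoning
    solve : ∀ x y → y ≡ (x +ℤ y) -ℤ x
    solve = solve-∀

  nbrCount-join : ∀ i u w j →
    + nbrCount (hs i) (join u w) j
      ≡ k *ℤ multiplicity w j +ℤ (a -ℤ k) *ℤ ⟦ colouring i u w ≟ᶠ j ⟧ +ℤ mat2 a' b' c' d' (colouring i u w) j
  nbrCount-join i u w j = begin
    + nbrCount (hs i) (join u w) j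
      ≡⟨ cong +_ (count-neighbours-join (λ v → hs i v ≟ᶠ j) u w) ⟩
    + count (λ u' → hs i (join u' w) ≟ᶠ j) (neighbours u)
      +ℤ + count (λ w' → hs i (join u w') ≟ᶠ j) (neighbours w)
      ≡⟨ cong₂ (λ x y → + x +ℤ + y) (count-≗ (λ u' → hs-join i u' w) j (neighbours u))
                                     (count-≗ (λ w' → hs-join i u w') j (neighbours w)) ⟩
    + count (Q? ∘ g) (neighbours u) +ℤ + nbrCount (fs t) w j
      ≡⟨ cong₂ _+ℤ_ (count-neighbours-kJEaE g-perfect Q? u) (proj₂ (fs-perfect t) w j) ⟩
    k *ℤ sum (λ c → ⟦ Q? c ⟧) +ℤ (a -ℤ k) *ℤ ⟦ Q? (g u) ⟧ +ℤ mat2 a' b' c' d' (fs t w) j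
      ≡⟨ cong (λ s → k *ℤ s +ℤ (a -ℤ k) *ℤ ⟦ Q? (g u) ⟧ +ℤ mat2 a' b' c' d' (fs t w) j)
              (sum-rotate (λ c → ⟦ fs c w ≟ᶠ j ⟧) i) ⟩
    k *ℤ multiplicity w j +ℤ (a -ℤ k) *ℤ ⟦ colouring i u w ≟ᶠ j ⟧ +ℤ mat2 a' b' c' d' (colouring i u w) j ∎
    where
    open ≡-Reasoning
    t = rotate (toℕ i) (g u)
    Q? = λ c → fs (rotate (toℕ i) c) w ≟ᶠ j

  hs-perfect : ∀ i → IsPerfectColoring (hs i) (productQuotient L k a r a' b' c' d')
  hs-perfect i = surjective , join-elim regular
    where
    surjective : ∀ j → ∃ λ v → hs i v ≡ j
    surjective j =
      let u = proj₁ (proj₁ g-perfect i)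
          w , fw≡j = proj₁ (fs-perfect (rotate (toℕ i) (g u))) j
      in join u w , trans (hs-join i u w) fw≡j
    regular : ∀ u w j → + nbrCount (hs i) (join u w) j ≡ productQuotient L k a r a' b' c' d' (hs i (join u w)) j
    regular u w j = begin
      + nbrCount (hs i) (join u w) j
        ≡⟨ nbrCount-join i u w j ⟩
      k *ℤ multiplicity w j +ℤ (a -ℤ k) *ℤ ⟦ colouring i u w ≟ᶠ j ⟧ +ℤ mat2 a' b' c' d' (colouring i u w) j
        ≡⟨ cong (λ x → k *ℤ x +ℤ (a -ℤ k) *ℤ ⟦ colouring i u w ≟ᶠ j ⟧ +ℤ mat2 a' b' c' d' (colouring i u w) j)
                (multiplicity≡classSize w j) ⟩
      k *ℤ classSize L r j +ℤ (a -ℤ k) *ℤ ⟦ colouring i u w ≟ᶠ j ⟧ +ℤ mat2 a' b' c' d' (colouring i u w) j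
        ≡⟨ productQuotient-entry L k a r a' b' c' d' (colouring i u w) j ⟩
      productQuotient L k a r a' b' c' d' (colouring i u w) j
        ≡⟨ cong (λ h → productQuotient L k a r a' b' c' d' h j) (sym (hs-join i u w)) ⟩
      productQuotient L k a r a' b' c' d' (hs i (join u w)) j ∎
      where open ≡-Reasoning

  hs-col1Count : ∀ v → + col1Count hs v ≡ r
  hs-col1Count = join-elim λ u w → begin
    + count (λ i → hs i (join u w) ≟ᶠ col1) (allFin L)
      ≡⟨ cong +_ (count-≗ (λ i → hs-join i u w) col1 (allFin L)) ⟩
    + count (λ i → colouring i u w ≟ᶠ col1) (allFin L)
      ≡⟨ count-tabulate (λ i → colouring i u w ≟ᶠ col1) id ⟩
    sum {L} (λ i → ⟦ fs (rotate (toℕ i) (g u)) w ≟ᶠ col1 ⟧)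
      ≡⟨ sum-cong-≗ {L} (λ i → cong (λ c → ⟦ fs c w ≟ᶠ col1 ⟧) (rotate-comm (g u) i)) ⟩
    sum {L} (λ i → ⟦ fs (rotate (toℕ (g u)) i) w ≟ᶠ col1 ⟧)
      ≡⟨ sum-rotate (λ c → ⟦ fs c w ≟ᶠ col1 ⟧) (g u) ⟩
    multiplicity w col1
      ≡⟨ multiplicity≡classSize w col1 ⟩
    r ∎
    where open ≡-Reasoning

proposition16 : (m n m' n' l : ℕ) (k a r a' b' c' d' : ℤ) →
    (∃ λ (g : V m n → Fin (2 ^ l)) → IsPerfectColoring g (kJEaE k a)) →
    (fs : Fin (2 ^ l) → V m' n' → Fin 2) →
    (∀ i → IsPerfectColoring (fs i) (mat2 a' b' c' d')) →
    (∀ (v : V m' n') → + col1Count fs v ≡ r) →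
    ∃ λ (hs : Fin (2 ^ l) → V (m + m') (n + n') → Fin 2) →
      (∀ i → IsPerfectColoring (hs i)
        (mat2 (a' +ℤ a +ℤ (r -ℤ + 1) *ℤ k)
              (b' +ℤ (+ (2 ^ l) -ℤ r) *ℤ k)
              (c' +ℤ r *ℤ k)
              (d' +ℤ (+ (2 ^ l) -ℤ r -ℤ + 1) *ℤ k +ℤ a))) ×
      (∀ (v : V (m + m') (n + n')) → + col1Count hs v ≡ r)
proposition16 m n m' n' l k a r a' b' c' d' (g , g-perfect) fs fs-perfect fs-col1Count =
  hs , hs-perfect , hs-col1Count
  where
  instance
    2^l≢0 : NonZero (2 ^ l)
    2^l≢0 = ℕ.m^n≢0 2 l
  open ProductConstruction g g-perfect fs fs-perfect fs-col1Count
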